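{- Let $A$ and $B$ be Gram mates. Then $J-A$ and $J-B$ are Gram mates, where $J$ is the all-ones matrix of the same size as $A$.
   Context: Two $(0,1)$ matrices $A,B$ of the same size are Gram mates if $AA^T=BB^T$, $A^TA=B^TB$ and $A\neq B$. -}

module Defs where

open import Data.Nat using (ℕ; zero; suc; _+_; _*_)
open import Data.Fin using (Fin; zero; suc)
open import Data.Bool using (Bool; true; false; not)
open import Data.Product using (_×_)
open import Relation.Binary.PropositionalEquality using (_≡_)
open import Relation.Nullary using (¬_)

-- A (0,1) matrix of size m × n: entries in Bool (true = 1, false = 0).
Mat01 : ℕ → ℕ → Set
Mat01 m n = Fin m → Fin n → Bool

val : Bool → ℕ
val true  = 1
val false = 0

sumFin : (n : ℕ) → (Fin n → ℕ) → ℕ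
sumFin zero    f = 0
sumFin (suc n) f = f zero + sumFin n (λ k → f (suc k))

AAᵀ : ∀ {m n} → Mat01 m n → Fin m → Fin m → ℕ
AAᵀ {n = n} A i i' = sumFin n (λ j → val (A i j) * val (A i' j))

AᵀA : ∀ {m n} → Mat01 m n → Fin n → Fin n → ℕ
AᵀA {m = m} A j j' = sumFin m (λ i → val (A i j) * val (A i j'))

_≋_ : ∀ {m n} → Mat01 m n → Mat01 m n → Set
A ≋ B = ∀ i j → A i j ≡ B i j

GramMates : ∀ {m n} → Mat01 m n → Mat01 m n → Set
GramMates A B =
  (∀ i i' → AAᵀ A i i' ≡ AAᵀ B i i')
  × (∀ j j' → AᵀA A j j' ≡ AᵀA B j j')
  × ¬ (A ≋ B)

-- J - A, with J the all-ones matrix (entry 1 - a = not a for a ∈ {0,1})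
J-_ : ∀ {m n} → Mat01 m n → Mat01 m n
(J- A) i j = not (A i j)

{-# OPTIONS --safe #-}
module Submission where

-- For 0/1 vectors x and y of length n, coordinatewise (1 - a)(1 - b) + a² + b² = 1 + ab
-- gives ⟨J - x, J - y⟩ + ⟨x, x⟩ + ⟨y, y⟩ = n + ⟨x, y⟩. So every entry of the Gram
-- matrices of J - A is determined by entries of the Gram matrices of A, and those of A
-- and B agree. Complementation is injective, so J - A ≠ J - B.

open import Defs
open import Data.Nat using (ℕ; zero; suc; _+_; _*_)
open import Data.Nat.Properties using (+-cancelʳ-≡; +-commutativeSemigroup)
open import Algebra.Properties.CommutativeSemigroup +-commutativeSemigroup
  using () renaming (interchange to +-interchange)
open import Data.Fin using (Fin; zero; suc)
open import Data.Bool using (Bool; true; false; not)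
open import Data.Bool.Properties using (not-injective)
open import Data.Product using (_,_)
open import Function using (_∘_)
open import Relation.Binary.PropositionalEquality
open ≡-Reasoning

sumFin-cong : ∀ n {f g : Fin n → ℕ} → (∀ k → f k ≡ g k) → sumFin n f ≡ sumFin n g
sumFin-cong zero    f≗g = refl
sumFin-cong (suc n) f≗g = cong₂ _+_ (f≗g zero) (sumFin-cong n (f≗g ∘ suc))

sumFin-+ : ∀ n (f g : Fin n → ℕ) → sumFin n (λ k → f k + g k) ≡ sumFin n f + sumFin n g
sumFin-+ zero    f g = refl
sumFin-+ (suc n) f g = begin
  (f zero + g zero) + sumFin n (λ k → f (suc k) + g (suc k))
    ≡⟨ cong (f zero + g zero +_) (sumFin-+ n (f ∘ suc) (g ∘ suc)) ⟩
  (f zero + g zero) + (sumFin n (f ∘ suc) + sumFin n (g ∘ suc))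
    ≡⟨ +-interchange (f zero) (g zero) _ _ ⟩
  (f zero + sumFin n (f ∘ suc)) + (g zero + sumFin n (g ∘ suc)) ∎

sumFin-one : ∀ n → sumFin n (λ _ → 1) ≡ n
sumFin-one zero    = refl
sumFin-one (suc n) = cong suc (sumFin-one n)

dot : ∀ {n} → (Fin n → Bool) → (Fin n → Bool) → ℕ
dot {n} x y = sumFin n (λ k → val (x k) * val (y k))

val-not-*-not : ∀ a b → val (not a) * val (not b) + val a * val a + val b * val b ≡ 1 + val a * val b
val-not-*-not true  true  = refl
val-not-*-not true  false = refl
val-not-*-not false true  = refl
val-not-*-not false false = refl

dot-complement : ∀ {n} (x y : Fin n → Bool) →
  dot (not ∘ x) (not ∘ y) + dot x x + dot y y ≡ n + dot x y
dot-complement {n} x y = begin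
  dot (not ∘ x) (not ∘ y) + dot x x + dot y y
    ≡⟨ cong (_+ dot y y) (sym (sumFin-+ n _ _)) ⟩
  sumFin n (λ k → val (not (x k)) * val (not (y k)) + val (x k) * val (x k)) + dot y y
    ≡⟨ sym (sumFin-+ n _ _) ⟩
  sumFin n (λ k → val (not (x k)) * val (not (y k)) + val (x k) * val (x k) + val (y k) * val (y k))
    ≡⟨ sumFin-cong n (λ k → val-not-*-not (x k) (y k)) ⟩
  sumFin n (λ k → 1 + val (x k) * val (y k))
    ≡⟨ sumFin-+ n _ _ ⟩
  sumFin n (λ _ → 1) + dot x y
    ≡⟨ cong (_+ dot x y) (sumFin-one n) ⟩
  n + dot x y ∎

dot-complement-cong : ∀ {n} {x x′ y y′ : Fin n → Bool} →
  dot x x ≡ dot x′ x′ → dot y y ≡ dot y′ y′ → dot x y ≡ dot x′ y′ →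
  dot (not ∘ x) (not ∘ y) ≡ dot (not ∘ x′) (not ∘ y′)
dot-complement-cong {x = x} {x′} {y} {y′} xx yy xy =
  +-cancelʳ-≡ (dot x x) _ _ (+-cancelʳ-≡ (dot y y) _ _ (begin
    dot (not ∘ x) (not ∘ y) + dot x x + dot y y     ≡⟨ dot-complement x y ⟩
    _ + dot x y                                     ≡⟨ cong (_ +_) xy ⟩
    _ + dot x′ y′                                   ≡⟨ sym (dot-complement x′ y′) ⟩
    dot (not ∘ x′) (not ∘ y′) + dot x′ x′ + dot y′ y′ ≡⟨ cong₂ (λ s t → _ + s + t) (sym xx) (sym yy) ⟩
    dot (not ∘ x′) (not ∘ y′) + dot x x + dot y y   ∎))

column : ∀ {m n} → Mat01 m n → Fin n → Fin m → Bool
column A j i = A i j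

proposition5p1 : (m n : ℕ) (A B : Mat01 m n) → GramMates A B → GramMates (J- A) (J- B)
proposition5p1 m n A B (rows , cols , A≉B) =
  (λ i i′ → dot-complement-cong {x = A i} {B i} {A i′} {B i′}
               (rows i i) (rows i′ i′) (rows i i′)) ,
  (λ j j′ → dot-complement-cong {x = column A j} {column B j} {column A j′} {column B j′}
               (cols j j) (cols j′ j′) (cols j j′)) ,
  λ J-A≋J-B → A≉B (λ i j → not-injective (J-A≋J-B i j))
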